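{- Let $(Q,O)$ be a rooted binary tree. The value of the game $G(Q,O,p)$ is a non-increasing function of $p$ on $(1/2,1]$: if $1\ge p>p'>1/2$ then the value of $G(Q,O,p)$ is at most the value of $G(Q,O,p')$.
   Context: A rooted binary tree $(Q,O)$ is a finite tree with nonnegative arc lengths and root $O$, every node of degree $3$ or $1$ except $O$, which may have degree $1$ or $2$. Branch nodes are nodes of degree $3$ and $O$ if of degree $2$; the two branches at a branch node $j$ are the components of the part of $Q$ beyond $j$ with $j$ removed. The game $G(Q,O,p)$, for $1/2<p\le1$: the Hider chooses a leaf node; the Searcher starts at $O$ and moves at unit speed along a depth-first tour (fully searching one branch at each branch node before the other). On first arrival at each branch node she receives a signal naming one of the two branches; if the Hider lies in one of them the signal names his branch with probability $p$ and the other with probability $1-p$, independently. She may choose which branch to search first depending on the signal (and on her own randomization). The payoff to the Hider is the time until the Searcher reaches him; the game is zero-sum and its value is taken in mixed strategies.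
   Formalization: The arc lengths, the signal accuracies $p$ and $p'$, and the probabilities of both players' mixed strategies, hence the values compared, are rational numbers. -}

module Defs where

open import Data.Rational using (ℚ; 0ℚ; 1ℚ; ½; _+_; _*_; _-_; _≤_; _<_)
open import Data.List using (List; []; _∷_; map; foldr)
open import Data.List.Relation.Unary.All using (All)
open import Data.Product using (_×_; _,_; proj₁; proj₂; ∃)
open import Data.Unit using (⊤)
open import Relation.Binary.PropositionalEquality using (_≡_)

-- A (sub)tree hanging below a node: either a leaf, or a branch node
-- (degree 3) with two child arcs (length, subtree).
data BT : Set where
  leaf : BT
  br   : (a : ℚ) → (l : BT) → (b : ℚ) → (r : BT) → BT

NonNegArcs : BT → Set
NonNegArcs leaf         = ⊤
NonNegArcs (br a l b r) = (0ℚ ≤ a) × NonNegArcs l × (0ℚ ≤ b) × NonNegArcs r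

-- A rooted binary tree (Q,O): the root O has degree 1 (one arc of length ℓ
-- to a subtree) or degree 2 (O is itself a branch node).
data RootedTree : Set where
  root1 : (ℓ : ℚ) → BT → RootedTree
  root2 : (a : ℚ) → BT → (b : ℚ) → BT → RootedTree

body : RootedTree → BT
body (root1 ℓ t)     = t
body (root2 a l b r) = br a l b r

offset : RootedTree → ℚ
offset (root1 ℓ t)     = ℓ
offset (root2 a l b r) = 0ℚ

NonNegArcsR : RootedTree → Set
NonNegArcsR T = (0ℚ ≤ offset T) × NonNegArcs (body T)

W : BT → ℚ
W leaf         = 0ℚ
W (br a l b r) = a + W l + b + W r

data Side : Set where
  L R : Side

flip : Side → Side
flip L = R
flip R = L

ind : Side → Side → ℚ
ind L L = 1ℚ
ind R R = 1ℚ
ind L R = 0ℚ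
ind R L = 0ℚ

-- Hider pure strategies: leaves of the tree.
data Leaf : BT → Set where
  here : Leaf leaf
  goL  : ∀ {a l b r} → Leaf l → Leaf (br a l b r)
  goR  : ∀ {a l b r} → Leaf r → Leaf (br a l b r)

-- Searcher pure strategies: at each branch node, a map from the signal
-- received there to the branch searched first (depth-first tour).
data Strat : BT → Set where
  sleaf : Strat leaf
  sbr   : ∀ {a l b r} → (Side → Side) → Strat l → Strat r → Strat (br a l b r)

two : ℚ
two = 1ℚ + 1ℚ

-- Probability that the searcher first searches the branch NOT containing
-- the Hider, when the Hider is in branch H: the signal names H with prob. p.
pWrong : ℚ → (Side → Side) → Side → ℚ
pWrong p f H = p * ind (f H) (flip H) + (1ℚ - p) * ind (f (flip H)) (flip H)

time : ℚ → (t : BT) → Strat t → Leaf t → ℚ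
time p leaf sleaf here = 0ℚ
time p (br a l b r) (sbr f sl sr) (goL h) =
  a + time p l sl h + (two * (b + W r)) * pWrong p f L
time p (br a l b r) (sbr f sl sr) (goR h) =
  b + time p r sr h + (two * (a + W l)) * pWrong p f R

payoff : ℚ → (T : RootedTree) → Strat (body T) → Leaf (body T) → ℚ
payoff p T s h = offset T + time p (body T) s h

Dist : Set → Set
Dist A = List (ℚ × A)

sumℚ : List ℚ → ℚ
sumℚ = foldr _+_ 0ℚ

IsDist : {A : Set} → Dist A → Set
IsDist d = All (λ wx → 0ℚ ≤ proj₁ wx) d × (sumℚ (map proj₁ d) ≡ 1ℚ)

E : {A : Set} → Dist A → (A → ℚ) → ℚ
E d f = sumℚ (map (λ wx → proj₁ wx * f (proj₂ wx)) d)

IsValue : RootedTree → ℚ → ℚ → Set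
IsValue T p v =
  (∃ λ (σ : Dist (Strat (body T))) → IsDist σ ×
     ((h : Leaf (body T)) → E σ (λ s → payoff p T s h) ≤ v))
  × (∃ λ (η : Dist (Leaf (body T))) → IsDist η ×
     ((s : Strat (body T)) → v ≤ E η (λ h → payoff p T s h)))

-- A signal of accuracy p can be degraded into one of accuracy p′ < p by
-- independently flipping it with probability (p − p′)/(2p − 1). So each pure
-- Searcher strategy in G(Q,O,p′) is reproduced, leaf by leaf and in
-- expectation, by a mixed strategy in G(Q,O,p) which uses the same rule with
-- probability (p + p′ − 1)/(2p − 1) and the swapped rule otherwise at every
-- branch node. Hence an optimal Hider strategy for p guarantees at least the
-- value v for p against every pure Searcher strategy for p′, so v ≤ v′.
module Submission where

open import Defs
open import Data.Rational using (ℚ; 1ℚ; ½; _≤_; _<_)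
open import Data.Rational as ℚ using (0ℚ; _+_; _*_; _-_; -_; 1/_)
open import Data.Rational.Properties
open import Data.Rational.Solver using (module +-*-Solver)
open import Data.List using ([]; _∷_; map; _++_)
open import Data.List.Relation.Unary.All as All using (All; []; _∷_)
open import Data.List.Relation.Unary.All.Properties using (++⁺; map⁺)
open import Data.Product using (_,_; proj₁; proj₂)
open import Relation.Binary.PropositionalEquality

mass : {A : Set} → Dist A → ℚ
mass d = sumℚ (map proj₁ d)

NonNegWeights : {A : Set} → Dist A → Set
NonNegWeights d = All (λ wx → 0ℚ ≤ proj₁ wx) d

nonNeg-* : {x y : ℚ} → 0ℚ ≤ x → 0ℚ ≤ y → 0ℚ ≤ x * y
nonNeg-* {x} {y} 0≤x 0≤y =
  nonNegative⁻¹ (x * y) {{nonNeg*nonNeg⇒nonNeg x {{ℚ.nonNegative 0≤x}} y {{ℚ.nonNegative 0≤y}}}}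

module _ {A : Set} where

  E-cong : (d : Dist A) {f g : A → ℚ} → (∀ x → f x ≡ g x) → E d f ≡ E d g
  E-cong []            f≡g = refl
  E-cong ((w , x) ∷ d) f≡g = cong₂ _+_ (cong (w *_) (f≡g x)) (E-cong d f≡g)

  E-+ : (d : Dist A) (f g : A → ℚ) → E d (λ x → f x + g x) ≡ E d f + E d g
  E-+ []            f g = sym (+-identityˡ 0ℚ)
  E-+ ((w , x) ∷ d) f g = begin
    w * (f x + g x) + E d (λ x → f x + g x)   ≡⟨ cong₂ _+_ (*-distribˡ-+ w (f x) (g x)) (E-+ d f g) ⟩
    (w * f x + w * g x) + (E d f + E d g)     ≡⟨ solve 4 (λ a b c e → (a :+ b) :+ (c :+ e) := (a :+ c) :+ (b :+ e))
                                                   refl (w * f x) (w * g x) (E d f) (E d g) ⟩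
    (w * f x + E d f) + (w * g x + E d g)     ∎
    where
    open ≡-Reasoning
    open +-*-Solver

  E-* : (d : Dist A) (k : ℚ) (f : A → ℚ) → E d (λ x → k * f x) ≡ k * E d f
  E-* []            k f = sym (*-zeroʳ k)
  E-* ((w , x) ∷ d) k f = begin
    w * (k * f x) + E d (λ x → k * f x)   ≡⟨ cong (w * (k * f x) +_) (E-* d k f) ⟩
    w * (k * f x) + k * E d f             ≡⟨ solve 4 (λ w k a b → w :* (k :* a) :+ k :* b := k :* (w :* a :+ b))
                                               refl w k (f x) (E d f) ⟩
    k * (w * f x + E d f)                 ∎
    where
    open ≡-Reasoning
    open +-*-Solver

  E-const : (d : Dist A) (k : ℚ) → E d (λ _ → k) ≡ k * mass d
  E-const []            k = sym (*-zeroʳ k)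
  E-const ((w , x) ∷ d) k = begin
    w * k + E d (λ _ → k)   ≡⟨ cong (w * k +_) (E-const d k) ⟩
    w * k + k * mass d      ≡⟨ solve 3 (λ w k s → w :* k :+ k :* s := k :* (w :+ s)) refl w k (mass d) ⟩
    k * (w + mass d)        ∎
    where
    open ≡-Reasoning
    open +-*-Solver

  mass≡E-1 : (d : Dist A) → mass d ≡ E d (λ _ → 1ℚ)
  mass≡E-1 d = sym (trans (E-const d 1ℚ) (*-identityˡ (mass d)))

  E-const-dist : {d : Dist A} → IsDist d → (k : ℚ) → E d (λ _ → k) ≡ k
  E-const-dist {d} (_ , mass≡1) k = trans (E-const d k) (trans (cong (k *_) mass≡1) (*-identityʳ k))

  E-affine : {d : Dist A} → IsDist d → (a k : ℚ) (f g : A → ℚ) →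
             E d (λ x → a + f x + k * g x) ≡ a + E d f + k * E d g
  E-affine {d} d-dist a k f g = begin
    E d (λ x → a + f x + k * g x)               ≡⟨ E-+ d (λ x → a + f x) (λ x → k * g x) ⟩
    E d (λ x → a + f x) + E d (λ x → k * g x)   ≡⟨ cong₂ _+_ (E-+ d (λ _ → a) f) (E-* d k g) ⟩
    E d (λ _ → a) + E d f + k * E d g           ≡⟨ cong (λ e → e + E d f + k * E d g) (E-const-dist d-dist a) ⟩
    a + E d f + k * E d g                       ∎
    where
    open ≡-Reasoning

  E-mono : {d : Dist A} → NonNegWeights d →
           {f g : A → ℚ} → (∀ x → f x ≤ g x) → E d f ≤ E d g
  E-mono {[]}          []            f≤g = ≤-refl
  E-mono {(w , x) ∷ d} (0≤w ∷ 0≤ws) f≤g =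
    +-mono-≤ (*-monoˡ-≤-nonNeg w {{ℚ.nonNegative 0≤w}} (f≤g x)) (E-mono 0≤ws f≤g)

  ≤-E : {d : Dist A} → IsDist d → {v : ℚ} {f : A → ℚ} → (∀ x → v ≤ f x) → v ≤ E d f
  ≤-E d-dist@(0≤ws , _) {v} {f} v≤f = subst (_≤ _) (E-const-dist d-dist v) (E-mono 0≤ws v≤f)

  E-≤ : {d : Dist A} → IsDist d → {v : ℚ} {f : A → ℚ} → (∀ x → f x ≤ v) → E d f ≤ v
  E-≤ d-dist@(0≤ws , _) {v} {f} f≤v = subst (_ ≤_) (E-const-dist d-dist v) (E-mono 0≤ws f≤v)

E-swap : {A B : Set} (d : Dist A) (e : Dist B) (f : A → B → ℚ) →
         E d (λ x → E e (f x)) ≡ E e (λ y → E d (λ x → f x y))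
E-swap []            e f = sym (trans (E-const e 0ℚ) (*-zeroˡ (mass e)))
E-swap ((w , x) ∷ d) e f = begin
  w * E e (f x) + E d (λ x → E e (f x))                   ≡⟨ cong₂ _+_ (sym (E-* e w (f x))) (E-swap d e f) ⟩
  E e (λ y → w * f x y) + E e (λ y → E d (λ x → f x y))   ≡⟨ sym (E-+ e _ _) ⟩
  E e (λ y → w * f x y + E d (λ x → f x y))               ∎
  where
  open ≡-Reasoning

dirac : {A : Set} → A → Dist A
dirac x = (1ℚ , x) ∷ []

mapDist : {A B : Set} → (A → B) → Dist A → Dist B
mapDist k = map (λ (w , x) → (w , k x))

scale : {A : Set} → ℚ → Dist A → Dist A
scale w = map (λ (u , x) → (w * u , x))

bind : {A B : Set} → Dist A → (A → Dist B) → Dist B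
bind []            k = []
bind ((w , x) ∷ d) k = scale w (k x) ++ bind d k

module _ {A : Set} where

  E-dirac : (x : A) (f : A → ℚ) → E (dirac x) f ≡ f x
  E-dirac x f = trans (+-identityʳ (1ℚ * f x)) (*-identityˡ (f x))

  E-++ : (d e : Dist A) (f : A → ℚ) → E (d ++ e) f ≡ E d f + E e f
  E-++ []            e f = sym (+-identityˡ (E e f))
  E-++ ((w , x) ∷ d) e f = trans (cong (w * f x +_) (E-++ d e f)) (sym (+-assoc (w * f x) (E d f) (E e f)))

  E-scale : (w : ℚ) (d : Dist A) (f : A → ℚ) → E (scale w d) f ≡ w * E d f
  E-scale w []            f = sym (*-zeroʳ w)
  E-scale w ((u , x) ∷ d) f = begin
    w * u * f x + E (scale w d) f   ≡⟨ cong (w * u * f x +_) (E-scale w d f) ⟩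
    w * u * f x + w * E d f         ≡⟨ solve 4 (λ w u a b → w :* u :* a :+ w :* b := w :* (u :* a :+ b))
                                         refl w u (f x) (E d f) ⟩
    w * (u * f x + E d f)           ∎
    where
    open ≡-Reasoning
    open +-*-Solver

  isDist-dirac : (x : A) → IsDist (dirac x)
  isDist-dirac x = (nonNegative⁻¹ 1ℚ ∷ []) , +-identityʳ 1ℚ

module _ {A B : Set} where

  E-mapDist : (k : A → B) (d : Dist A) (f : B → ℚ) → E (mapDist k d) f ≡ E d (λ x → f (k x))
  E-mapDist k []            f = refl
  E-mapDist k ((w , x) ∷ d) f = cong (w * f (k x) +_) (E-mapDist k d f)

  E-bind : (d : Dist A) (k : A → Dist B) (f : B → ℚ) → E (bind d k) f ≡ E d (λ x → E (k x) f)
  E-bind []            k f = refl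
  E-bind ((w , x) ∷ d) k f = begin
    E (scale w (k x) ++ bind d k) f         ≡⟨ E-++ (scale w (k x)) (bind d k) f ⟩
    E (scale w (k x)) f + E (bind d k) f    ≡⟨ cong₂ _+_ (E-scale w (k x) f) (E-bind d k f) ⟩
    w * E (k x) f + E d (λ x → E (k x) f)   ∎
    where
    open ≡-Reasoning

  isDist-mapDist : (k : A → B) {d : Dist A} → IsDist d → IsDist (mapDist k d)
  isDist-mapDist k {d} (0≤ws , mass≡1) =
    map⁺ 0≤ws , trans (mass≡E-1 (mapDist k d)) (trans (E-mapDist k d _) (trans (sym (mass≡E-1 d)) mass≡1))

  isDist-bind : {d : Dist A} → IsDist d → {k : A → Dist B} → (∀ x → IsDist (k x)) → IsDist (bind d k)
  isDist-bind {d} d-dist {k} k-dist = nonNeg-bind (proj₁ d-dist) , (begin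
    mass (bind d k)                 ≡⟨ mass≡E-1 (bind d k) ⟩
    E (bind d k) (λ _ → 1ℚ)         ≡⟨ E-bind d k (λ _ → 1ℚ) ⟩
    E d (λ x → E (k x) (λ _ → 1ℚ))  ≡⟨ E-cong d (λ x → E-const-dist (k-dist x) 1ℚ) ⟩
    E d (λ _ → 1ℚ)                  ≡⟨ E-const-dist d-dist 1ℚ ⟩
    1ℚ                              ∎)
    where
    open ≡-Reasoning
    nonNeg-bind : {d : Dist A} → NonNegWeights d → NonNegWeights (bind d k)
    nonNeg-bind []           = []
    nonNeg-bind {(_ , x) ∷ _} (0≤w ∷ 0≤ws) =
      ++⁺ (map⁺ (All.map (nonNeg-* 0≤w) (proj₁ (k-dist x)))) (nonNeg-bind 0≤ws)

value-≤-under-simulation :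
  {S S′ H : Set} (P : S → H → ℚ) (P′ : S′ → H → ℚ) (simulate : S′ → Dist S) →
  (∀ s′ → IsDist (simulate s′)) → (∀ s′ h → E (simulate s′) (λ s → P s h) ≡ P′ s′ h) →
  {v v′ : ℚ} (η : Dist H) → IsDist η → (∀ s → v ≤ E η (P s)) →
  (σ′ : Dist S′) → IsDist σ′ → (∀ h → E σ′ (λ s′ → P′ s′ h) ≤ v′) → v ≤ v′
value-≤-under-simulation P P′ simulate simulate-dist E-simulate {v} {v′}
                         η η-dist v≤η σ′ σ′-dist σ′≤v′ = begin
  v                                      ≤⟨ ≤-E σ′-dist v≤η∘P′ ⟩
  E σ′ (λ s′ → E η (P′ s′))              ≡⟨ E-swap σ′ η P′ ⟩
  E η (λ h → E σ′ (λ s′ → P′ s′ h))      ≤⟨ E-≤ η-dist σ′≤v′ ⟩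
  v′                                     ∎
  where
  open ≤-Reasoning
  v≤η∘P′ : ∀ s′ → v ≤ E η (P′ s′)
  v≤η∘P′ s′ = begin
    v                                            ≤⟨ ≤-E (simulate-dist s′) v≤η ⟩
    E (simulate s′) (λ s → E η (P s))            ≡⟨ E-swap (simulate s′) η P ⟩
    E η (λ h → E (simulate s′) (λ s → P s h))    ≡⟨ E-cong η (E-simulate s′) ⟩
    E η (P′ s′)                                  ∎

≤⇒0≤- : {x y : ℚ} → x ≤ y → 0ℚ ≤ y - x
≤⇒0≤- {x} {y} x≤y = subst (_≤ y - x) (+-inverseʳ x) (+-monoˡ-≤ (- x) x≤y)

<⇒0<- : {x y : ℚ} → x < y → 0ℚ < y - x
<⇒0<- {x} {y} x<y = subst (_< y - x) (+-inverseʳ x) (+-monoˡ-< (- x) x<y)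

sbr-rule : ∀ {a l b r} → Strat (br a l b r) → Side → Side
sbr-rule (sbr f _ _) = f

sbr-left : ∀ {a l b r} → Strat (br a l b r) → Strat l
sbr-left (sbr _ sl _) = sl

sbr-right : ∀ {a l b r} → Strat (br a l b r) → Strat r
sbr-right (sbr _ _ sr) = sr

time-goL : (p : ℚ) {a b : ℚ} {l r : BT} (s : Strat (br a l b r)) (h : Leaf l) →
           time p (br a l b r) s (goL h)
             ≡ a + time p l (sbr-left s) h + two * (b + W r) * pWrong p (sbr-rule s) L
time-goL p (sbr f sl sr) h = refl

time-goR : (p : ℚ) {a b : ℚ} {l r : BT} (s : Strat (br a l b r)) (h : Leaf r) →
           time p (br a l b r) s (goR h)
             ≡ b + time p r (sbr-right s) h + two * (a + W l) * pWrong p (sbr-rule s) R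
time-goR p (sbr f sl sr) h = refl

module Garbling (p p′ : ℚ) (½<p′ : ½ < p′) (p′<p : p′ < p) where

  α β : ℚ
  α = p′ + p - 1ℚ
  β = p - p′

  0≤α : 0ℚ ≤ α
  0≤α = ≤⇒0≤- (+-mono-≤ (<⇒≤ ½<p′) (<⇒≤ (<-trans ½<p′ p′<p)))

  0<β : 0ℚ < β
  0<β = <⇒0<- p′<p

  0<α+β : 0ℚ < α + β
  0<α+β = +-mono-≤-< 0≤α 0<β

  ι : ℚ
  ι = (1/ (α + β)) {{ℚ.>-nonZero 0<α+β}}

  0≤ι : 0ℚ ≤ ι
  0≤ι = <⇒≤ (positive⁻¹ ι {{1/pos⇒pos (α + β) {{ℚ.positive 0<α+β}}}})

  ι*[α+β]≡1 : ι * (α + β) ≡ 1ℚ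
  ι*[α+β]≡1 = *-inverseˡ (α + β) {{ℚ.>-nonZero 0<α+β}}

  garble : (Side → Side) → Dist (Side → Side)
  garble f = (α * ι , f) ∷ (β * ι , λ s → f (flip s)) ∷ []

  isDist-garble : (f : Side → Side) → IsDist (garble f)
  isDist-garble f = (nonNeg-* 0≤α 0≤ι ∷ nonNeg-* (<⇒≤ 0<β) 0≤ι ∷ []) , (begin
    α * ι + (β * ι + 0ℚ)   ≡⟨ solve 3 (λ a b i → a :* i :+ (b :* i :+ con 0ℚ) := i :* (a :+ b)) refl α β ι ⟩
    ι * (α + β)            ≡⟨ ι*[α+β]≡1 ⟩
    1ℚ                     ∎)
    where
    open ≡-Reasoning
    open +-*-Solver

  -- α p + β (1 − p) = p′ (2p − 1) = p′ (α + β).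
  garble-mixes : (X Y : ℚ) →
    α * ι * (p * X + (1ℚ - p) * Y) + (β * ι * (p * Y + (1ℚ - p) * X) + 0ℚ) ≡ p′ * X + (1ℚ - p′) * Y
  garble-mixes X Y = begin
    α * ι * (p * X + (1ℚ - p) * Y) + (β * ι * (p * Y + (1ℚ - p) * X) + 0ℚ)
      ≡⟨ solve 5 (λ p p′ i X Y →
           (p′ :+ p :- con 1ℚ) :* i :* (p :* X :+ (con 1ℚ :- p) :* Y)
             :+ ((p :- p′) :* i :* (p :* Y :+ (con 1ℚ :- p) :* X) :+ con 0ℚ)
           := (i :* ((p′ :+ p :- con 1ℚ) :+ (p :- p′))) :* (p′ :* X :+ (con 1ℚ :- p′) :* Y))
         refl p p′ ι X Y ⟩
    ι * (α + β) * (p′ * X + (1ℚ - p′) * Y)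
      ≡⟨ cong (_* (p′ * X + (1ℚ - p′) * Y)) ι*[α+β]≡1 ⟩
    1ℚ * (p′ * X + (1ℚ - p′) * Y)
      ≡⟨ *-identityˡ _ ⟩
    p′ * X + (1ℚ - p′) * Y
      ∎
    where
    open ≡-Reasoning
    open +-*-Solver

  E-garble-pWrong : (f : Side → Side) (H : Side) → E (garble f) (λ g → pWrong p g H) ≡ pWrong p′ f H
  E-garble-pWrong f L = garble-mixes (ind (f L) R) (ind (f R) R)
  E-garble-pWrong f R = garble-mixes (ind (f R) L) (ind (f L) L)

  simulate : {t : BT} → Strat t → Dist (Strat t)
  simulate sleaf         = dirac sleaf
  simulate (sbr f sl sr) =
    bind (garble f) λ g → bind (simulate sl) λ x → mapDist (sbr g x) (simulate sr)

  isDist-simulate : {t : BT} (s : Strat t) → IsDist (simulate s)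
  isDist-simulate sleaf         = isDist-dirac sleaf
  isDist-simulate (sbr f sl sr) =
    isDist-bind (isDist-garble f) λ g →
      isDist-bind (isDist-simulate sl) λ x → isDist-mapDist (sbr g x) (isDist-simulate sr)

  module _ {a b : ℚ} {l r : BT} (f : Side → Side) (sl : Strat l) (sr : Strat r) where

    E-simulate-sbr : (F : Strat (br a l b r) → ℚ) →
      E (simulate (sbr f sl sr)) F
        ≡ E (garble f) (λ g → E (simulate sl) (λ x → E (simulate sr) (λ y → F (sbr g x y))))
    E-simulate-sbr F = begin
      E (simulate (sbr f sl sr)) F
        ≡⟨ E-bind (garble f) (λ g → bind (simulate sl) λ x → mapDist (sbr g x) (simulate sr)) F ⟩
      E (garble f) (λ g → E (bind (simulate sl) λ x → mapDist (sbr g x) (simulate sr)) F)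
        ≡⟨ E-cong (garble f) (λ g → E-bind (simulate sl) (λ x → mapDist (sbr g x) (simulate sr)) F) ⟩
      E (garble f) (λ g → E (simulate sl) (λ x → E (mapDist (sbr g x) (simulate sr)) F))
        ≡⟨ E-cong (garble f) (λ g → E-cong (simulate sl) (λ x → E-mapDist (sbr g x) (simulate sr) F)) ⟩
      E (garble f) (λ g → E (simulate sl) (λ x → E (simulate sr) (λ y → F (sbr g x y))))
        ∎
      where
      open ≡-Reasoning

    E-simulate-rule : (φ : (Side → Side) → ℚ) →
      E (simulate (sbr f sl sr)) (λ s → φ (sbr-rule s)) ≡ E (garble f) φ
    E-simulate-rule φ = trans (E-simulate-sbr _) (E-cong (garble f) λ g →
      trans (E-cong (simulate sl) λ _ → E-const-dist (isDist-simulate sr) (φ g))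
            (E-const-dist (isDist-simulate sl) (φ g)))

    E-simulate-left : (φ : Strat l → ℚ) →
      E (simulate (sbr f sl sr)) (λ s → φ (sbr-left s)) ≡ E (simulate sl) φ
    E-simulate-left φ = trans (E-simulate-sbr _)
      (trans (E-cong (garble f) λ _ → E-cong (simulate sl) λ x → E-const-dist (isDist-simulate sr) (φ x))
             (E-const-dist (isDist-garble f) (E (simulate sl) φ)))

    E-simulate-right : (φ : Strat r → ℚ) →
      E (simulate (sbr f sl sr)) (λ s → φ (sbr-right s)) ≡ E (simulate sr) φ
    E-simulate-right φ = trans (E-simulate-sbr _)
      (trans (E-cong (garble f) λ _ → E-const-dist (isDist-simulate sl) (E (simulate sr) φ))
             (E-const-dist (isDist-garble f) (E (simulate sr) φ)))

  E-time-simulate : {t : BT} (s′ : Strat t) (h : Leaf t) →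
    E (simulate s′) (λ s → time p t s h) ≡ time p′ t s′ h
  E-time-simulate sleaf here = E-dirac sleaf (λ s → time p leaf s here)
  E-time-simulate {br a l b r} s′@(sbr f sl sr) (goL h) = begin
    E (simulate s′) (λ s → time p _ s (goL h))
      ≡⟨ E-cong (simulate s′) (λ s → time-goL p s h) ⟩
    E (simulate s′) (λ s → a + time p l (sbr-left s) h + K * pWrong p (sbr-rule s) L)
      ≡⟨ E-affine (isDist-simulate s′) a K _ _ ⟩
    a + E (simulate s′) (λ s → time p l (sbr-left s) h)
      + K * E (simulate s′) (λ s → pWrong p (sbr-rule s) L)
      ≡⟨ cong₂ (λ u w → a + u + K * w)
           (trans (E-simulate-left f sl sr _) (E-time-simulate sl h))
           (trans (E-simulate-rule f sl sr _) (E-garble-pWrong f L)) ⟩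
    a + time p′ l sl h + K * pWrong p′ f L
      ∎
    where
    open ≡-Reasoning
    K : ℚ
    K = two * (b + W r)
  E-time-simulate {br a l b r} s′@(sbr f sl sr) (goR h) = begin
    E (simulate s′) (λ s → time p _ s (goR h))
      ≡⟨ E-cong (simulate s′) (λ s → time-goR p s h) ⟩
    E (simulate s′) (λ s → b + time p r (sbr-right s) h + K * pWrong p (sbr-rule s) R)
      ≡⟨ E-affine (isDist-simulate s′) b K _ _ ⟩
    b + E (simulate s′) (λ s → time p r (sbr-right s) h)
      + K * E (simulate s′) (λ s → pWrong p (sbr-rule s) R)
      ≡⟨ cong₂ (λ u w → b + u + K * w)
           (trans (E-simulate-right f sl sr _) (E-time-simulate sr h))
           (trans (E-simulate-rule f sl sr _) (E-garble-pWrong f R)) ⟩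
    b + time p′ r sr h + K * pWrong p′ f R
      ∎
    where
    open ≡-Reasoning
    K : ℚ
    K = two * (a + W l)

  E-payoff-simulate : (T : RootedTree) (s′ : Strat (body T)) (h : Leaf (body T)) →
    E (simulate s′) (λ s → payoff p T s h) ≡ payoff p′ T s′ h
  E-payoff-simulate T s′ h = begin
    E (simulate s′) (λ s → offset T + time p (body T) s h)
      ≡⟨ E-+ (simulate s′) _ _ ⟩
    E (simulate s′) (λ _ → offset T) + E (simulate s′) (λ s → time p (body T) s h)
      ≡⟨ cong₂ _+_ (E-const-dist (isDist-simulate s′) (offset T)) (E-time-simulate s′ h) ⟩
    offset T + time p′ (body T) s′ h
      ∎
    where
    open ≡-Reasoning

proposition2 : (T : RootedTree) → NonNegArcsR T →
    (p p′ : ℚ) → p ≤ 1ℚ → p′ < p → ½ < p′ →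
    (v v′ : ℚ) → IsValue T p v → IsValue T p′ v′ → v ≤ v′
proposition2 T _ p p′ _ p′<p ½<p′ v v′ (_ , η , η-dist , v≤η) ((σ′ , σ′-dist , σ′≤v′) , _) =
  value-≤-under-simulation (payoff p T) (payoff p′ T) simulate isDist-simulate (E-payoff-simulate T)
    η η-dist v≤η σ′ σ′-dist σ′≤v′
  where
  open Garbling p p′ ½<p′ p′<p
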